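{- In $\mathbf{G}(\mathsf{FBInqBQ})$ the following hold. (i) If $\vdash_h\Gamma\Rightarrow\Delta$ then $\vdash_h\Gamma[z/x]\Rightarrow\Delta[z/x]$, where $\Theta[z/x]:=\{X:\varphi[z/x]\mid X:\varphi\in\Theta\}$. (ii) The weakening rules are height-preserving admissible: if $\vdash_h\Gamma\Rightarrow\Delta$ then $\vdash_h\Gamma\Rightarrow\Delta,X:\varphi$ and $\vdash_h X:\varphi,\Gamma\Rightarrow\Delta$. (iii) All rules of $\mathbf{G}(\mathsf{FBInqBQ})$ are height-preserving invertible: whenever the conclusion of a rule instance is derivable with height at most $h$, each premise of that rule instance is derivable with height at most $h$. (iv) The contraction rules are height-preserving admissible: if $\vdash_h\Gamma\Rightarrow\Delta,X:\varphi,X:\varphi$ then $\vdash_h\Gamma\Rightarrow\Delta,X:\varphi$, and if $\vdash_h X:\varphi,X:\varphi,\Gamma\Rightarrow\Delta$ then $\vdash_h X:\varphi,\Gamma\Rightarrow\Delta$.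
   Context: Language: countably infinite set of variables, countably infinite set of predicate symbols with arities (no identity, constants, function symbols). Formulas: $\varphi ::= P(x_1,\dots,x_m)\mid \bot\mid \varphi\to\varphi\mid\varphi\wedge\varphi\mid \varphi\veebar\varphi\mid \forall x\varphi\mid \bar\exists x\varphi$ ($\veebar$ inquisitive disjunction, $\bar\exists$ inquisitive existential). $\varphi[z/x]$ is capture-avoiding substitution. Calculus $\mathbf{G}(\mathsf{FBInqBQ})$: a label is a nonempty finite subset of $\omega$; a labelled formula is $X:\varphi$ with $X$ a label; a sequent $\Gamma\Rightarrow\Delta$ is a pair of finite multisets of labelled formulas. $X,Y$ range over labels. Initial sequents: $(\mathtt{id})$ $X:P(\bar x),\Gamma\Rightarrow\Delta,Y:P(\bar x)$ whenever $X\supseteq Y$; $(\bot\Rightarrow)$ $X:\bot,\Gamma\Rightarrow\Delta$. Rules (premises / conclusion): $(\Rightarrow\mathtt{at})$: $\Gamma\Rightarrow\Delta,\{k\}:P(\bar x)$ for every $k\in X$ / $\Gamma\Rightarrow\Delta,X:P(\bar x)$. $(\Rightarrow\wedge)$: $\Gamma\Rightarrow\Delta,X:\varphi$ and $\Gamma\Rightarrow\Delta,X:\psi$ / $\Gamma\Rightarrow\Delta,X:\varphi\wedge\psi$. $(\wedge\Rightarrow)$: $X:\varphi,X:\psi,\Gamma\Rightarrow\Delta$ / $X:\varphi\wedge\psi,\Gamma\Rightarrow\Delta$. $(\Rightarrow\veebar)$: $\Gamma\Rightarrow\Delta,X:\varphi,X:\psi$ / $\Gamma\Rightarrow\Delta,X:\varphi\veebar\psi$.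 $(\veebar\Rightarrow)$: $X:\varphi,\Gamma\Rightarrow\Delta$ and $X:\psi,\Gamma\Rightarrow\Delta$ / $X:\varphi\veebar\psi,\Gamma\Rightarrow\Delta$. $(\Rightarrow\to)$: $Y:\varphi,\Gamma\Rightarrow\Delta,Y:\psi$ for every label $Y\subseteq X$ / $\Gamma\Rightarrow\Delta,X:\varphi\to\psi$. $(\to\Rightarrow)$, for a label $Y\subseteq X$: $X:\varphi\to\psi,\Gamma\Rightarrow\Delta,Y:\varphi$ and $Y:\psi,X:\varphi\to\psi,\Gamma\Rightarrow\Delta$ / $X:\varphi\to\psi,\Gamma\Rightarrow\Delta$. $(\Rightarrow\forall)$: $\Gamma\Rightarrow\Delta,X:\varphi[z/x]$ / $\Gamma\Rightarrow\Delta,X:\forall x\varphi$, with $z$ not occurring in the conclusion. $(\forall\Rightarrow)$: $X:\varphi[y/x],X:\forall x\varphi,\Gamma\Rightarrow\Delta$ / $X:\forall x\varphi,\Gamma\Rightarrow\Delta$ ($y$ arbitrary). $(\Rightarrow\bar\exists)$: $\Gamma\Rightarrow\Delta,X:\bar\exists x\varphi,X:\varphi[y/x]$ / $\Gamma\Rightarrow\Delta,X:\bar\exists x\varphi$ ($y$ arbitrary). $(\bar\exists\Rightarrow)$: $X:\varphi[z/x],\Gamma\Rightarrow\Delta$ / $X:\bar\exists x\varphi,\Gamma\Rightarrow\Delta$, with $z$ not occurring in the conclusion. A derivation is a finite tree of sequents built from initial sequents by these rules; its height is the length of its longest branch. $\vdash_h\Gamma\Rightarrow\Delta$ means $\Gamma\Rightarrow\Delta$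 has a derivation of height at most $h$. -}

module Defs where

open import Data.Nat using (ℕ; zero; suc; _+_; _⊔_; _≡ᵇ_)
open import Data.Bool using (Bool; true; false; if_then_else_; not)
open import Data.List using (List; []; _∷_; _++_; map; filter; foldr; concatMap)
open import Data.Bool.ListAction using (any)
open import Data.List.NonEmpty using (List⁺; _∷_; [_])
open import Data.Vec using (Vec; toList)
import Data.Vec as Vec
open import Data.Product using (_×_; _,_; Σ)
open import Data.Sum using (_⊎_)
open import Data.List.Membership.Propositional using (_∈_; _∉_)
open import Data.List.Relation.Binary.Permutation.Propositional using (_↭_)
open import Relation.Binary.PropositionalEquality using (_≡_)
open import Relation.Nullary using (¬_)

Var : Set
Var = ℕ

-- A predicate symbol is given by its arity n and an index i : ℕ
-- (countably many symbols of each arity); the atom P(x₁,…,xₙ) is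
-- 'atom n i (x₁ ∷ … ∷ xₙ ∷ [])'.
infixr 6 _∧'_
infixr 5 _∨'_
infixr 4 _⇒'_

data Fm : Set where
  atom : (n i : ℕ) → Vec Var n → Fm
  ⊥'   : Fm
  _⇒'_ : Fm → Fm → Fm
  _∧'_ : Fm → Fm → Fm
  _∨'_ : Fm → Fm → Fm          -- inquisitive disjunction ⩡
  ∀'   : Var → Fm → Fm
  ∃'   : Var → Fm → Fm          -- inquisitive existential ∃̄

vars : Fm → List Var
vars (atom n i xs) = toList xs
vars ⊥'       = []
vars (φ ⇒' ψ) = vars φ ++ vars ψ
vars (φ ∧' ψ) = vars φ ++ vars ψ
vars (φ ∨' ψ) = vars φ ++ vars ψ
vars (∀' x φ) = x ∷ vars φ
vars (∃' x φ) = x ∷ vars φ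

fv : Fm → List Var
fv (atom n i xs) = toList xs
fv ⊥'       = []
fv (φ ⇒' ψ) = fv φ ++ fv ψ
fv (φ ∧' ψ) = fv φ ++ fv ψ
fv (φ ∨' ψ) = fv φ ++ fv ψ
fv (∀' x φ) = Data.List.filterᵇ (λ u → not (u ≡ᵇ x)) (fv φ)
fv (∃' x φ) = Data.List.filterᵇ (λ u → not (u ≡ᵇ x)) (fv φ)

_[_↦_] : (Var → Var) → Var → Var → (Var → Var)
(σ [ y ↦ w ]) u = if u ≡ᵇ y then w else σ u

elemᵇ : Var → List Var → Bool
elemᵇ y l = any (λ u → u ≡ᵇ y) l

-- the bound variable used when pushing σ under a binder for y whose
-- body's free variables (other than y) are mapped by σ to 'avoid':
-- keep y if this causes no capture, otherwise take a fresh variable.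
binder : Var → List Var → Var
binder y avoid = if elemᵇ y avoid then suc (foldr _⊔_ 0 avoid) else y

ren : (Var → Var) → Fm → Fm
ren σ (atom n i xs) = atom n i (Vec.map σ xs)
ren σ ⊥'       = ⊥'
ren σ (φ ⇒' ψ) = ren σ φ ⇒' ren σ ψ
ren σ (φ ∧' ψ) = ren σ φ ∧' ren σ ψ
ren σ (φ ∨' ψ) = ren σ φ ∨' ren σ ψ
ren σ (∀' y φ) =
  let w = binder y (map σ (fv (∀' y φ))) in ∀' w (ren (σ [ y ↦ w ]) φ)
ren σ (∃' y φ) =
  let w = binder y (map σ (fv (∃' y φ))) in ∃' w (ren (σ [ y ↦ w ]) φ)

_[_/_] : Fm → Var → Var → Fm
φ [ z / x ] = ren ((λ u → u) [ x ↦ z ]) φ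

-- Labels: nonempty finite subsets of ω, in a canonical encoding.
-- n ∷ (d₁ ∷ d₂ ∷ …) encodes {n, n+1+d₁, n+1+d₁+1+d₂, …}
-- (first element, then gaps); every nonempty finite subset of ω has
-- exactly one code.

Label : Set
Label = List⁺ ℕ

elems : Label → List ℕ
elems (n ∷ ds) = n ∷ go n ds
  where
  go : ℕ → List ℕ → List ℕ
  go m []       = []
  go m (d ∷ ds) = suc (m + d) ∷ go (suc (m + d)) ds

_∈L_ : ℕ → Label → Set
k ∈L X = k ∈ elems X

_⊆L_ : Label → Label → Set
Y ⊆L X = ∀ {k} → k ∈L Y → k ∈L X

sing : ℕ → Label
sing k = [ k ]

-- Labelled formulas and sequents (multisets represented by lists;
-- derivability below is invariant under permutation by construction)

LFm : Set
LFm = Label × Fm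

Seq : Set
Seq = List LFm × List LFm

_≈S_ : Seq → Seq → Set
(Γ , Δ) ≈S (Γ' , Δ') = (Γ ↭ Γ') × (Δ ↭ Δ')

varsCtx : List LFm → List Var
varsCtx = concatMap (λ { (X , φ) → vars φ })

varsSeq : Seq → List Var
varsSeq (Γ , Δ) = varsCtx Γ ++ varsCtx Δ

substCtx : Var → Var → List LFm → List LFm
substCtx z x = map (λ { (X , φ) → (X , φ [ z / x ]) })

data Initial : Seq → Set where
  ax-id : ∀ Γ Δ X Y n i (xs : Vec Var n) → Y ⊆L X →
          Initial ((X , atom n i xs) ∷ Γ , (Y , atom n i xs) ∷ Δ)
  ax-⊥  : ∀ Γ Δ X → Initial ((X , ⊥') ∷ Γ , Δ)

data Rule : Set where
  R⇒at : (Γ Δ : List LFm) (X : Label) (n i : ℕ) (xs : Vec Var n) → Rule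
  R⇒∧  : (Γ Δ : List LFm) (X : Label) (φ ψ : Fm) → Rule
  R∧⇒  : (Γ Δ : List LFm) (X : Label) (φ ψ : Fm) → Rule
  R⇒∨  : (Γ Δ : List LFm) (X : Label) (φ ψ : Fm) → Rule
  R∨⇒  : (Γ Δ : List LFm) (X : Label) (φ ψ : Fm) → Rule
  R⇒→  : (Γ Δ : List LFm) (X : Label) (φ ψ : Fm) → Rule
  R→⇒  : (Γ Δ : List LFm) (X Y : Label) (φ ψ : Fm) → Y ⊆L X → Rule
  R⇒∀  : (Γ Δ : List LFm) (X : Label) (x : Var) (φ : Fm) (z : Var) →
         z ∉ varsSeq (Γ , (X , ∀' x φ) ∷ Δ) → Rule
  R∀⇒  : (Γ Δ : List LFm) (X : Label) (x : Var) (φ : Fm) (y : Var) → Rule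
  R⇒∃  : (Γ Δ : List LFm) (X : Label) (x : Var) (φ : Fm) (y : Var) → Rule
  R∃⇒  : (Γ Δ : List LFm) (X : Label) (x : Var) (φ : Fm) (z : Var) →
         z ∉ varsSeq ((X , ∃' x φ) ∷ Γ , Δ) → Rule

concl : Rule → Seq
concl (R⇒at Γ Δ X n i xs)     = Γ , (X , atom n i xs) ∷ Δ
concl (R⇒∧ Γ Δ X φ ψ)         = Γ , (X , φ ∧' ψ) ∷ Δ
concl (R∧⇒ Γ Δ X φ ψ)         = (X , φ ∧' ψ) ∷ Γ , Δ
concl (R⇒∨ Γ Δ X φ ψ)         = Γ , (X , φ ∨' ψ) ∷ Δ
concl (R∨⇒ Γ Δ X φ ψ)         = (X , φ ∨' ψ) ∷ Γ , Δ
concl (R⇒→ Γ Δ X φ ψ)         = Γ , (X , φ ⇒' ψ) ∷ Δ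
concl (R→⇒ Γ Δ X Y φ ψ _)     = (X , φ ⇒' ψ) ∷ Γ , Δ
concl (R⇒∀ Γ Δ X x φ z _)     = Γ , (X , ∀' x φ) ∷ Δ
concl (R∀⇒ Γ Δ X x φ y)       = (X , ∀' x φ) ∷ Γ , Δ
concl (R⇒∃ Γ Δ X x φ y)       = Γ , (X , ∃' x φ) ∷ Δ
concl (R∃⇒ Γ Δ X x φ z _)     = (X , ∃' x φ) ∷ Γ , Δ

Prem : Rule → Seq → Set
Prem (R⇒at Γ Δ X n i xs) s =
  Σ ℕ λ k → k ∈L X × s ≡ (Γ , (sing k , atom n i xs) ∷ Δ)
Prem (R⇒∧ Γ Δ X φ ψ) s =
  s ≡ (Γ , (X , φ) ∷ Δ) ⊎ s ≡ (Γ , (X , ψ) ∷ Δ)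
Prem (R∧⇒ Γ Δ X φ ψ) s =
  s ≡ ((X , φ) ∷ (X , ψ) ∷ Γ , Δ)
Prem (R⇒∨ Γ Δ X φ ψ) s =
  s ≡ (Γ , (X , φ) ∷ (X , ψ) ∷ Δ)
Prem (R∨⇒ Γ Δ X φ ψ) s =
  s ≡ ((X , φ) ∷ Γ , Δ) ⊎ s ≡ ((X , ψ) ∷ Γ , Δ)
Prem (R⇒→ Γ Δ X φ ψ) s =
  Σ Label λ Y → Y ⊆L X × s ≡ ((Y , φ) ∷ Γ , (Y , ψ) ∷ Δ)
Prem (R→⇒ Γ Δ X Y φ ψ _) s =
  s ≡ ((X , φ ⇒' ψ) ∷ Γ , (Y , φ) ∷ Δ)
  ⊎ s ≡ ((Y , ψ) ∷ (X , φ ⇒' ψ) ∷ Γ , Δ)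
Prem (R⇒∀ Γ Δ X x φ z _) s =
  s ≡ (Γ , (X , φ [ z / x ]) ∷ Δ)
Prem (R∀⇒ Γ Δ X x φ y) s =
  s ≡ ((X , φ [ y / x ]) ∷ (X , ∀' x φ) ∷ Γ , Δ)
Prem (R⇒∃ Γ Δ X x φ y) s =
  s ≡ (Γ , (X , ∃' x φ) ∷ (X , φ [ y / x ]) ∷ Δ)
Prem (R∃⇒ Γ Δ X x φ z _) s =
  s ≡ ((X , φ [ z / x ]) ∷ Γ , Δ)

-- ⊢[ h ] s : s has a derivation of height at most h
-- (initial sequents have height 0; a rule application adds 1)

data ⊢[_]_ : ℕ → Seq → Set where
  init : ∀ {h s t} → s ≈S t → Initial t → ⊢[ h ] s
  rule : ∀ {h s} (r : Rule) → s ≈S concl r →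
         (∀ t → Prem r t → ⊢[ h ] t) → ⊢[ suc h ] s

module Submission where

-- Capture-avoiding renaming chooses fresh binders, so it commutes with other
-- renamings only up to α-equivalence; formulas are therefore compared through
-- their locally nameless forms. The central fact: from a derivation of s one
-- gets, with the same height, a derivation of any sequent that contains an
-- α-variant of a renaming of s (induction on the derivation, replacing
-- eigenvariables by fresh ones). It yields substitution, weakening and
-- renaming of eigenvariables. The rules →⇒, ∀⇒ and ⇒∃ repeat their
-- conclusion in their premises, so they are inverted by weakening; the other
-- rules are inverted by induction on the derivation: when the inverted
-- formula is principal its premise is (up to eigenvariable renaming) already
-- the required sequent, and otherwise the last rule is permuted below the
-- inversion. Contraction is again by induction, inverting the second copy when
-- the first one is principal.

open import Defs
open import Data.Nat using (ℕ; suc; _≡ᵇ_; _⊔_; _≤_)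
open import Data.Nat.Properties using (≡ᵇ⇒≡; ≡⇒≡ᵇ; m≤m⊔n; m≤n⊔m; ≤-trans; n≮n)
open import Data.Bool using (true; false; if_then_else_; not; T)
open import Data.Bool.Properties using (T-≡; ¬-not)
open import Data.List using (List; []; _∷_; _++_; _∷ʳ_; [_]; map; foldr)
open import Data.List.Properties using (++-identityʳ)
open import Data.List.Membership.Propositional using (_∈_; _∉_)
open import Data.List.Membership.Propositional.Properties
  using (∈-++⁺ˡ; ∈-++⁺ʳ; ∈-map⁺; ∈-filter⁺; ∈-filter⁻; ∈-∃++)
open import Data.List.Relation.Unary.Any using (here; there)
import Data.List.Relation.Unary.Any as Any
open import Data.List.Relation.Unary.Any.Properties using (any⁺)
open import Data.List.Relation.Binary.Pointwise as Pointwise using (Pointwise; []; _∷_)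
open import Data.List.Relation.Binary.Permutation.Propositional as ↭
  using (_↭_; ↭-refl; ↭-sym; ↭-trans; ↭-prep; ↭-swap; ↭-reflexive)
open import Data.List.Relation.Binary.Permutation.Propositional.Properties
  using (drop-∷; ∈-resp-↭; ++⁺ʳ; ∷↭∷ʳ) renaming (shift to ↭-shift)
open import Data.List.Relation.Binary.Subset.Propositional using (_⊆_)
open import Data.List.Relation.Binary.Subset.Propositional.Properties
  using (++⁺; ⊆-reflexive-↭; xs⊆x∷xs; xs⊆ys++xs)
  renaming (++⁺ˡ to ⊆-++⁺ˡ; ++⁺ʳ to ⊆-++⁺ʳ)
open import Data.Vec as Vec using (Vec)
open import Data.Vec.Properties using (map-∘; ∷-injectiveˡ; ∷-injectiveʳ)
open import Data.Product using (Σ-syntax; _×_; _,_; proj₁)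
open import Data.Sum using (_⊎_; inj₁; inj₂)
open import Data.Empty using (⊥)
open import Function using (id; _∘_; Equivalence)
open import Relation.Binary.PropositionalEquality hiding ([_])

≡ᵇ-refl : ∀ n → (n ≡ᵇ n) ≡ true
≡ᵇ-refl n = Equivalence.to T-≡ (≡⇒≡ᵇ n n refl)

≢⇒≡ᵇ-false : ∀ {m n} → m ≢ n → (m ≡ᵇ n) ≡ false
≢⇒≡ᵇ-false {m} {n} m≢n = ¬-not (λ e → m≢n (≡ᵇ⇒≡ m n (Equivalence.from T-≡ e)))

update-≢ : ∀ (σ : Var → Var) {y} w {u} → u ≢ y → (σ [ y ↦ w ]) u ≡ σ u
update-≢ σ w u≢y rewrite ≢⇒≡ᵇ-false u≢y = refl

fresh : List Var → Var
fresh vs = suc (foldr _⊔_ 0 vs)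

fresh∉ : ∀ vs → fresh vs ∉ vs
fresh∉ vs v∈ = n≮n _ (≤-max vs v∈)
  where
  ≤-max : ∀ {v} vs → v ∈ vs → v ≤ foldr _⊔_ 0 vs
  ≤-max (w ∷ vs) (here refl) = m≤m⊔n w _
  ≤-max (w ∷ vs) (there v∈) = ≤-trans (≤-max vs v∈) (m≤n⊔m w _)

binder∉ : ∀ y avoid → binder y avoid ∉ avoid
binder∉ y avoid with elemᵇ y avoid in eq
... | true  = fresh∉ avoid
... | false = λ y∈ → subst T eq (any⁺ _ (Any.map (λ { refl → ≡⇒≡ᵇ y y refl }) y∈))

∈-fv-∀ : ∀ x φ {u} → u ∈ fv φ → (u ≡ᵇ x) ≡ false → u ∈ fv (∀' x φ)
∈-fv-∀ x φ u∈ u≢x = ∈-filter⁺ _ u∈ (subst (T ∘ not) (sym u≢x) _)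

fv⊆vars : ∀ φ → fv φ ⊆ vars φ
fv⊆vars (atom n i xs) = id
fv⊆vars ⊥'            = id
fv⊆vars (φ ⇒' ψ)      = ++⁺ (fv⊆vars φ) (fv⊆vars ψ)
fv⊆vars (φ ∧' ψ)      = ++⁺ (fv⊆vars φ) (fv⊆vars ψ)
fv⊆vars (φ ∨' ψ)      = ++⁺ (fv⊆vars φ) (fv⊆vars ψ)
fv⊆vars (∀' x φ)      = there ∘ fv⊆vars φ ∘ proj₁ ∘ ∈-filter⁻ _
fv⊆vars (∃' x φ)      = there ∘ fv⊆vars φ ∘ proj₁ ∘ ∈-filter⁻ _

-- Locally nameless forms: ⌊ φ ⌋ ≡ ⌊ ψ ⌋ exactly when φ and ψ are α-equivalent.
data Idx : Set where
  bound : ℕ → Idx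
  free  : Var → Idx

data Fmᴰ : Set where
  atomᴰ : (n i : ℕ) → Vec Idx n → Fmᴰ
  ⊥ᴰ    : Fmᴰ
  _⇒ᴰ_ _∧ᴰ_ _∨ᴰ_ : Fmᴰ → Fmᴰ → Fmᴰ
  ∀ᴰ ∃ᴰ : Fmᴰ → Fmᴰ

Env : Set
Env = Var → Idx

shift : Idx → Idx
shift (bound k) = bound (suc k)
shift (free v)  = free v

_↑_ : Env → Var → Env
(ρ ↑ y) u = if u ≡ᵇ y then bound 0 else shift (ρ u)

db : Env → Fm → Fmᴰ
db ρ (atom n i xs) = atomᴰ n i (Vec.map ρ xs)
db ρ ⊥'            = ⊥ᴰ
db ρ (φ ⇒' ψ)      = db ρ φ ⇒ᴰ db ρ ψ
db ρ (φ ∧' ψ)      = db ρ φ ∧ᴰ db ρ ψ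
db ρ (φ ∨' ψ)      = db ρ φ ∨ᴰ db ρ ψ
db ρ (∀' y φ)      = ∀ᴰ (db (ρ ↑ y) φ)
db ρ (∃' y φ)      = ∃ᴰ (db (ρ ↑ y) φ)

⌊_⌋ : Fm → Fmᴰ
⌊ φ ⌋ = db free φ

⌊_∣_⌋ : Fm → (Var → Var) → Fmᴰ
⌊ φ ∣ σ ⌋ = db (free ∘ σ) φ

↑-cong : ∀ {ρ ρ′} y φ → (∀ u → u ∈ fv (∀' y φ) → ρ u ≡ ρ′ u) →
         ∀ u → u ∈ fv φ → (ρ ↑ y) u ≡ (ρ′ ↑ y) u
↑-cong y φ e u u∈ with u ≡ᵇ y in u≢y
... | true  = refl
... | false = cong shift (e u (∈-fv-∀ y φ u∈ u≢y))

db-cong : ∀ {ρ ρ′} φ → (∀ u → u ∈ fv φ → ρ u ≡ ρ′ u) → db ρ φ ≡ db ρ′ φ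
db-cong (atom n i xs) e = cong (atomᴰ n i) (map-cong∈ xs e)
  where
  map-cong∈ : ∀ {A : Set} {f g : Var → A} {n} (xs : Vec Var n) →
              (∀ u → u ∈ Vec.toList xs → f u ≡ g u) → Vec.map f xs ≡ Vec.map g xs
  map-cong∈ Vec.[]       e = refl
  map-cong∈ (x Vec.∷ xs) e = cong₂ Vec._∷_ (e x (here refl)) (map-cong∈ xs (λ u → e u ∘ there))
db-cong ⊥'       e = refl
db-cong (φ ⇒' ψ) e = cong₂ _⇒ᴰ_ (db-cong φ (λ u → e u ∘ ∈-++⁺ˡ)) (db-cong ψ (λ u → e u ∘ ∈-++⁺ʳ (fv φ)))
db-cong (φ ∧' ψ) e = cong₂ _∧ᴰ_ (db-cong φ (λ u → e u ∘ ∈-++⁺ˡ)) (db-cong ψ (λ u → e u ∘ ∈-++⁺ʳ (fv φ)))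
db-cong (φ ∨' ψ) e = cong₂ _∨ᴰ_ (db-cong φ (λ u → e u ∘ ∈-++⁺ˡ)) (db-cong ψ (λ u → e u ∘ ∈-++⁺ʳ (fv φ)))
db-cong (∀' y φ) e = cong ∀ᴰ (db-cong φ (↑-cong y φ e))
db-cong (∃' y φ) e = cong ∃ᴰ (db-cong φ (↑-cong y φ e))

-- The binder w chosen by ren avoids the renamed free variables, so it captures nothing.
↑-ren : ∀ (ρ : Env) (σ : Var → Var) y φ w → w ∉ map σ (fv (∀' y φ)) →
        ∀ u → u ∈ fv φ → (ρ ↑ w) ((σ [ y ↦ w ]) u) ≡ ((ρ ∘ σ) ↑ y) u
↑-ren ρ σ y φ w w∉ u u∈ with u ≡ᵇ y in u≢y
... | true rewrite ≡ᵇ-refl w = refl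
... | false rewrite ≢⇒≡ᵇ-false {σ u} {w} (λ { refl → w∉ (∈-map⁺ σ (∈-fv-∀ y φ u∈ u≢y)) }) = refl

db-ren : ∀ ρ σ φ → db ρ (ren σ φ) ≡ db (ρ ∘ σ) φ
db-ren ρ σ (atom n i xs) = cong (atomᴰ n i) (sym (map-∘ ρ σ xs))
db-ren ρ σ ⊥'            = refl
db-ren ρ σ (φ ⇒' ψ)      = cong₂ _⇒ᴰ_ (db-ren ρ σ φ) (db-ren ρ σ ψ)
db-ren ρ σ (φ ∧' ψ)      = cong₂ _∧ᴰ_ (db-ren ρ σ φ) (db-ren ρ σ ψ)
db-ren ρ σ (φ ∨' ψ)      = cong₂ _∨ᴰ_ (db-ren ρ σ φ) (db-ren ρ σ ψ)
db-ren ρ σ (∀' y φ)      =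
  cong ∀ᴰ (trans (db-ren (ρ ↑ w) (σ [ y ↦ w ]) φ) (db-cong φ (↑-ren ρ σ y φ w (binder∉ y _))))
  where w = binder y (map σ (fv (∀' y φ)))
db-ren ρ σ (∃' y φ)      =
  cong ∃ᴰ (trans (db-ren (ρ ↑ w) (σ [ y ↦ w ]) φ) (db-cong φ (↑-ren ρ σ y φ w (binder∉ y _))))
  where w = binder y (map σ (fv (∃' y φ)))

openᴵ : ℕ → Var → Idx → Idx
openᴵ d t (bound k) = if k ≡ᵇ d then free t else bound k
openᴵ d t (free u)  = free u

openᴰ : ℕ → Var → Fmᴰ → Fmᴰ
openᴰ d t (atomᴰ n i is) = atomᴰ n i (Vec.map (openᴵ d t) is)
openᴰ d t ⊥ᴰ             = ⊥ᴰ
openᴰ d t (a ⇒ᴰ b)       = openᴰ d t a ⇒ᴰ openᴰ d t b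
openᴰ d t (a ∧ᴰ b)       = openᴰ d t a ∧ᴰ openᴰ d t b
openᴰ d t (a ∨ᴰ b)       = openᴰ d t a ∨ᴰ openᴰ d t b
openᴰ d t (∀ᴰ a)         = ∀ᴰ (openᴰ (suc d) t a)
openᴰ d t (∃ᴰ a)         = ∃ᴰ (openᴰ (suc d) t a)

openᴵ-↑ : ∀ d t (ρ : Env) y u → openᴵ (suc d) t ((ρ ↑ y) u) ≡ ((openᴵ d t ∘ ρ) ↑ y) u
openᴵ-↑ d t ρ y u with u ≡ᵇ y
... | true  = refl
... | false = openᴵ-shift (ρ u)
  where
  openᴵ-shift : ∀ i → openᴵ (suc d) t (shift i) ≡ shift (openᴵ d t i)
  openᴵ-shift (bound k) with k ≡ᵇ d
  ... | true  = refl
  ... | false = refl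
  openᴵ-shift (free v) = refl

openᴰ-db : ∀ d t ρ φ → openᴰ d t (db ρ φ) ≡ db (openᴵ d t ∘ ρ) φ
openᴰ-db d t ρ (atom n i xs) = cong (atomᴰ n i) (sym (map-∘ (openᴵ d t) ρ xs))
openᴰ-db d t ρ ⊥'            = refl
openᴰ-db d t ρ (φ ⇒' ψ)      = cong₂ _⇒ᴰ_ (openᴰ-db d t ρ φ) (openᴰ-db d t ρ ψ)
openᴰ-db d t ρ (φ ∧' ψ)      = cong₂ _∧ᴰ_ (openᴰ-db d t ρ φ) (openᴰ-db d t ρ ψ)
openᴰ-db d t ρ (φ ∨' ψ)      = cong₂ _∨ᴰ_ (openᴰ-db d t ρ φ) (openᴰ-db d t ρ ψ)
openᴰ-db d t ρ (∀' y φ)      =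
  cong ∀ᴰ (trans (openᴰ-db (suc d) t (ρ ↑ y) φ) (db-cong φ (λ u _ → openᴵ-↑ d t ρ y u)))
openᴰ-db d t ρ (∃' y φ)      =
  cong ∃ᴰ (trans (openᴰ-db (suc d) t (ρ ↑ y) φ) (db-cong φ (λ u _ → openᴵ-↑ d t ρ y u)))

open-body : ∀ σ x t φ → openᴰ 0 t (db ((free ∘ σ) ↑ x) φ) ≡ ⌊ φ ∣ σ [ x ↦ t ] ⌋
open-body σ x t φ = trans (openᴰ-db 0 t _ φ) (db-cong φ (λ u _ → opened u))
  where
  opened : ∀ u → openᴵ 0 t (((free ∘ σ) ↑ x) u) ≡ free ((σ [ x ↦ t ]) u)
  opened u with u ≡ᵇ x
  ... | true  = refl
  ... | false = refl

⌊subst⌋ : ∀ φ x t → ⌊ φ [ t / x ] ⌋ ≡ openᴰ 0 t (db (free ↑ x) φ)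
⌊subst⌋ φ x t = trans (db-ren free (id [ x ↦ t ]) φ) (sym (open-body id x t φ))

subst-α : ∀ σ x φ y ψ t → db (free ↑ y) ψ ≡ db ((free ∘ σ) ↑ x) φ →
          ⌊ ψ [ t / y ] ⌋ ≡ ⌊ φ ∣ σ [ x ↦ t ] ⌋
subst-α σ x φ y ψ t bodies = begin
  ⌊ ψ [ t / y ] ⌋                    ≡⟨ ⌊subst⌋ ψ y t ⟩
  openᴰ 0 t (db (free ↑ y) ψ)        ≡⟨ cong (openᴰ 0 t) bodies ⟩
  openᴰ 0 t (db ((free ∘ σ) ↑ x) φ)  ≡⟨ open-body σ x t φ ⟩
  ⌊ φ ∣ σ [ x ↦ t ] ⌋                ∎
  where open ≡-Reasoning

subst-ren : ∀ σ x y φ → ⌊ φ [ y / x ] ∣ σ ⌋ ≡ ⌊ φ ∣ σ [ x ↦ σ y ] ⌋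
subst-ren σ x y φ = trans (db-ren (free ∘ σ) (id [ x ↦ y ]) φ) (db-cong φ (λ u _ → renamed u))
  where
  renamed : ∀ u → free (σ ((id [ x ↦ y ]) u)) ≡ free ((σ [ x ↦ σ y ]) u)
  renamed u with u ≡ᵇ x
  ... | true  = refl
  ... | false = refl

update-fresh : ∀ σ z z′ φ → z ∉ vars φ → ⌊ φ ∣ σ [ z ↦ z′ ] ⌋ ≡ ⌊ φ ∣ σ ⌋
update-fresh σ z z′ φ z∉ =
  db-cong φ (λ u u∈ → cong free (update-≢ σ z′ (λ { refl → z∉ (fv⊆vars φ u∈) })))

subst-eigen : ∀ σ x φ z z′ → z ∉ vars (∀' x φ) → ⌊ φ [ z / x ] ∣ σ [ z ↦ z′ ] ⌋ ≡ ⌊ φ ∣ σ [ x ↦ z′ ] ⌋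
subst-eigen σ x φ z z′ z∉ = trans (db-ren (free ∘ σ [ z ↦ z′ ]) (id [ x ↦ z ]) φ) (db-cong φ renamed)
  where
  renamed : ∀ u → u ∈ fv φ → free ((σ [ z ↦ z′ ]) ((id [ x ↦ z ]) u)) ≡ free ((σ [ x ↦ z′ ]) u)
  renamed u u∈ with u ≡ᵇ x
  ... | true rewrite ≡ᵇ-refl z = refl
  ... | false = cong free (update-≢ σ z′ (λ { refl → z∉ (there (fv⊆vars φ u∈)) }))

instance-renamed : ∀ σ x φ y ψ t → db (free ↑ y) ψ ≡ db ((free ∘ σ) ↑ x) φ →
                   ⌊ ψ [ σ t / y ] ⌋ ≡ ⌊ φ [ t / x ] ∣ σ ⌋
instance-renamed σ x φ y ψ t bodies = trans (subst-α σ x φ y ψ (σ t) bodies) (sym (subst-ren σ x t φ))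

eigen-renamed : ∀ σ x φ y ψ z z′ → z ∉ vars (∀' x φ) → db (free ↑ y) ψ ≡ db ((free ∘ σ) ↑ x) φ →
                ⌊ ψ [ z′ / y ] ⌋ ≡ ⌊ φ [ z / x ] ∣ σ [ z ↦ z′ ] ⌋
eigen-renamed σ x φ y ψ z z′ z∉ bodies = trans (subst-α σ x φ y ψ z′ bodies) (sym (subst-eigen σ x φ z z′ z∉))

⌊⌋≡atomᴰ : ∀ {A n i is} → ⌊ A ⌋ ≡ atomᴰ n i is →
           Σ[ ys ∈ Vec Var n ] A ≡ atom n i ys × Vec.map free ys ≡ is
⌊⌋≡atomᴰ {atom _ _ ys} refl = ys , refl , refl
⌊⌋≡atomᴰ {⊥'}     ()
⌊⌋≡atomᴰ {_ ⇒' _} ()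
⌊⌋≡atomᴰ {_ ∧' _} ()
⌊⌋≡atomᴰ {_ ∨' _} ()
⌊⌋≡atomᴰ {∀' _ _} ()
⌊⌋≡atomᴰ {∃' _ _} ()

⌊⌋≡⊥ᴰ : ∀ {A} → ⌊ A ⌋ ≡ ⊥ᴰ → A ≡ ⊥'
⌊⌋≡⊥ᴰ {⊥'}          refl = refl
⌊⌋≡⊥ᴰ {atom _ _ _}  ()
⌊⌋≡⊥ᴰ {_ ⇒' _}      ()
⌊⌋≡⊥ᴰ {_ ∧' _}      ()
⌊⌋≡⊥ᴰ {_ ∨' _}      ()
⌊⌋≡⊥ᴰ {∀' _ _}      ()
⌊⌋≡⊥ᴰ {∃' _ _}      ()

⌊⌋≡⇒ᴰ : ∀ {A a b} → ⌊ A ⌋ ≡ a ⇒ᴰ b → Σ[ φ ∈ Fm ] Σ[ ψ ∈ Fm ] A ≡ (φ ⇒' ψ) × ⌊ φ ⌋ ≡ a × ⌊ ψ ⌋ ≡ b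
⌊⌋≡⇒ᴰ {φ ⇒' ψ}      refl = φ , ψ , refl , refl , refl
⌊⌋≡⇒ᴰ {atom _ _ _}  ()
⌊⌋≡⇒ᴰ {⊥'}          ()
⌊⌋≡⇒ᴰ {_ ∧' _}      ()
⌊⌋≡⇒ᴰ {_ ∨' _}      ()
⌊⌋≡⇒ᴰ {∀' _ _}      ()
⌊⌋≡⇒ᴰ {∃' _ _}      ()

⌊⌋≡∧ᴰ : ∀ {A a b} → ⌊ A ⌋ ≡ a ∧ᴰ b → Σ[ φ ∈ Fm ] Σ[ ψ ∈ Fm ] A ≡ (φ ∧' ψ) × ⌊ φ ⌋ ≡ a × ⌊ ψ ⌋ ≡ b
⌊⌋≡∧ᴰ {φ ∧' ψ}      refl = φ , ψ , refl , refl , refl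
⌊⌋≡∧ᴰ {atom _ _ _}  ()
⌊⌋≡∧ᴰ {⊥'}          ()
⌊⌋≡∧ᴰ {_ ⇒' _}      ()
⌊⌋≡∧ᴰ {_ ∨' _}      ()
⌊⌋≡∧ᴰ {∀' _ _}      ()
⌊⌋≡∧ᴰ {∃' _ _}      ()

⌊⌋≡∨ᴰ : ∀ {A a b} → ⌊ A ⌋ ≡ a ∨ᴰ b → Σ[ φ ∈ Fm ] Σ[ ψ ∈ Fm ] A ≡ (φ ∨' ψ) × ⌊ φ ⌋ ≡ a × ⌊ ψ ⌋ ≡ b
⌊⌋≡∨ᴰ {φ ∨' ψ}      refl = φ , ψ , refl , refl , refl
⌊⌋≡∨ᴰ {atom _ _ _}  ()
⌊⌋≡∨ᴰ {⊥'}          ()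
⌊⌋≡∨ᴰ {_ ⇒' _}      ()
⌊⌋≡∨ᴰ {_ ∧' _}      ()
⌊⌋≡∨ᴰ {∀' _ _}      ()
⌊⌋≡∨ᴰ {∃' _ _}      ()

⌊⌋≡∀ᴰ : ∀ {A b} → ⌊ A ⌋ ≡ ∀ᴰ b → Σ[ y ∈ Var ] Σ[ ψ ∈ Fm ] A ≡ ∀' y ψ × db (free ↑ y) ψ ≡ b
⌊⌋≡∀ᴰ {∀' y ψ}      refl = y , ψ , refl , refl
⌊⌋≡∀ᴰ {atom _ _ _}  ()
⌊⌋≡∀ᴰ {⊥'}          ()
⌊⌋≡∀ᴰ {_ ⇒' _}      ()
⌊⌋≡∀ᴰ {_ ∧' _}      ()
⌊⌋≡∀ᴰ {_ ∨' _}      ()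
⌊⌋≡∀ᴰ {∃' _ _}      ()

⌊⌋≡∃ᴰ : ∀ {A b} → ⌊ A ⌋ ≡ ∃ᴰ b → Σ[ y ∈ Var ] Σ[ ψ ∈ Fm ] A ≡ ∃' y ψ × db (free ↑ y) ψ ≡ b
⌊⌋≡∃ᴰ {∃' y ψ}      refl = y , ψ , refl , refl
⌊⌋≡∃ᴰ {atom _ _ _}  ()
⌊⌋≡∃ᴰ {⊥'}          ()
⌊⌋≡∃ᴰ {_ ⇒' _}      ()
⌊⌋≡∃ᴰ {_ ∧' _}      ()
⌊⌋≡∃ᴰ {_ ∨' _}      ()
⌊⌋≡∃ᴰ {∀' _ _}      ()

⌊⌋-atom : ∀ {A n i} σ xs → ⌊ A ⌋ ≡ ⌊ atom n i xs ∣ σ ⌋ → A ≡ atom n i (Vec.map σ xs)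
⌊⌋-atom σ xs e with ys , refl , ys≡ ← ⌊⌋≡atomᴰ e =
  cong (atom _ _) (map-free-injective (trans ys≡ (map-∘ free σ xs)))
  where
  map-free-injective : ∀ {n} {ys zs : Vec Var n} → Vec.map free ys ≡ Vec.map free zs → ys ≡ zs
  map-free-injective {ys = Vec.[]}     {Vec.[]}     _ = refl
  map-free-injective {ys = y Vec.∷ ys} {z Vec.∷ zs} e with refl ← ∷-injectiveˡ e =
    cong (y Vec.∷_) (map-free-injective (∷-injectiveʳ e))

≈S-refl : ∀ {s} → s ≈S s
≈S-refl = ↭-refl , ↭-refl

≈S-reflexive : ∀ {s t} → s ≡ t → s ≈S t
≈S-reflexive refl = ≈S-refl

≈S-sym : ∀ {s t} → s ≈S t → t ≈S s
≈S-sym (p , q) = ↭-sym p , ↭-sym q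

≈S-trans : ∀ {s t u} → s ≈S t → t ≈S u → s ≈S u
≈S-trans (p , q) (p′ , q′) = ↭-trans p p′ , ↭-trans q q′

data Side : Set where
  L R : Side

plug : Side → LFm → Seq → Seq
plug L p (Γ , Δ) = p ∷ Γ , Δ
plug R p (Γ , Δ) = Γ , p ∷ Δ

Signed : Set
Signed = Side × LFm

infixr 25 _⊕_

_⊕_ : List Signed → Seq → Seq
a ⊕ C = foldr (λ (sd , p) → plug sd p) C a

plug-≈ : ∀ sd p {C C′} → C ≈S C′ → plug sd p C ≈S plug sd p C′
plug-≈ L p (Γ≈ , Δ≈) = ↭-prep p Γ≈ , Δ≈
plug-≈ R p (Γ≈ , Δ≈) = Γ≈ , ↭-prep p Δ≈

plug-swap : ∀ s₁ p₁ s₂ p₂ C → plug s₁ p₁ (plug s₂ p₂ C) ≈S plug s₂ p₂ (plug s₁ p₁ C)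
plug-swap L p₁ L p₂ C = ↭-swap p₁ p₂ ↭-refl , ↭-refl
plug-swap L p₁ R p₂ C = ≈S-refl
plug-swap R p₁ L p₂ C = ≈S-refl
plug-swap R p₁ R p₂ C = ↭-refl , ↭-swap p₁ p₂ ↭-refl

⊕-≈ : ∀ a {C C′} → C ≈S C′ → a ⊕ C ≈S a ⊕ C′
⊕-≈ []              C≈ = C≈
⊕-≈ ((sd , p) ∷ a) C≈ = plug-≈ sd p (⊕-≈ a C≈)

⊕-plug : ∀ a sd p C → a ⊕ plug sd p C ≈S plug sd p (a ⊕ C)
⊕-plug []               sd p C = ≈S-refl
⊕-plug ((sd′ , q) ∷ a) sd p C = ≈S-trans (plug-≈ sd′ q (⊕-plug a sd p C)) (plug-swap sd′ q sd p (a ⊕ C))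

⊕-comm : ∀ a b C → a ⊕ b ⊕ C ≈S b ⊕ a ⊕ C
⊕-comm a []              C = ≈S-refl
⊕-comm a ((sd , p) ∷ b) C = ≈S-trans (⊕-plug a sd p (b ⊕ C)) (plug-≈ sd p (⊕-comm a b C))

∈⇒↭∷ : ∀ {x : LFm} {Γ} → x ∈ Γ → Σ[ Γ₀ ∈ List LFm ] Γ ↭ x ∷ Γ₀
∈⇒↭∷ {x} x∈ with Γ₁ , Γ₂ , refl ← ∈-∃++ x∈ = Γ₁ ++ Γ₂ , ↭-shift x Γ₁ Γ₂

∷-↭-split : ∀ {a b : LFm} {Γ Γ′} → a ∷ Γ ↭ b ∷ Γ′ →
            (a ≡ b × Γ ↭ Γ′) ⊎ Σ[ Γ₀ ∈ List LFm ] Γ ↭ b ∷ Γ₀ × Γ′ ↭ a ∷ Γ₀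
∷-↭-split {a} {b} a∷Γ↭ with ∈-resp-↭ a∷Γ↭ (here refl)
... | here refl = inj₁ (refl , drop-∷ a∷Γ↭)
... | there a∈ with Γ₁ , Γ₂ , refl ← ∈-∃++ a∈ =
  inj₂ (Γ₁ ++ Γ₂ , drop-∷ (↭-trans a∷Γ↭ (↭-shift a (b ∷ Γ₁) Γ₂)) , ↭-shift a Γ₁ Γ₂)

plug-split : ∀ s₀ p₀ C₀ s₁ p₁ C₁ → plug s₀ p₀ C₀ ≈S plug s₁ p₁ C₁ →
             (s₀ ≡ s₁ × p₀ ≡ p₁ × C₀ ≈S C₁)
             ⊎ Σ[ C ∈ Seq ] C₀ ≈S plug s₁ p₁ C × C₁ ≈S plug s₀ p₀ C
plug-split L p₀ (Γ₀ , Δ₀) L p₁ (Γ₁ , Δ₁) (Γ≈ , Δ≈) with ∷-↭-split Γ≈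
... | inj₁ (refl , Γ≈′)      = inj₁ (refl , refl , Γ≈′ , Δ≈)
... | inj₂ (Γ , Γ₀≈ , Γ₁≈) = inj₂ ((Γ , Δ₀) , (Γ₀≈ , ↭-refl) , (Γ₁≈ , ↭-sym Δ≈))
plug-split L p₀ (Γ₀ , Δ₀) R p₁ (Γ₁ , Δ₁) (Γ≈ , Δ≈) = inj₂ ((Γ₀ , Δ₁) , (↭-refl , Δ≈) , (↭-sym Γ≈ , ↭-refl))
plug-split R p₀ (Γ₀ , Δ₀) L p₁ (Γ₁ , Δ₁) (Γ≈ , Δ≈) = inj₂ ((Γ₁ , Δ₀) , (Γ≈ , ↭-refl) , (↭-refl , ↭-sym Δ≈))
plug-split R p₀ (Γ₀ , Δ₀) R p₁ (Γ₁ , Δ₁) (Γ≈ , Δ≈) with ∷-↭-split Δ≈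
... | inj₁ (refl , Δ≈′)      = inj₁ (refl , refl , Γ≈ , Δ≈′)
... | inj₂ (Δ , Δ₀≈ , Δ₁≈) = inj₂ ((Γ₀ , Δ) , (↭-refl , Δ₀≈) , (↭-sym Γ≈ , Δ₁≈))

∉-plug : ∀ {z} sd X A C → z ∉ varsSeq (plug sd (X , A) C) → z ∉ vars A × z ∉ varsSeq C
∉-plug L X A (Γ , Δ) z∉ =
  z∉ ∘ ∈-++⁺ˡ ∘ ∈-++⁺ˡ , z∉ ∘ ⊆-++⁺ˡ (varsCtx Δ) (xs⊆ys++xs (varsCtx Γ) (vars A))
∉-plug R X A (Γ , Δ) z∉ =
  z∉ ∘ ∈-++⁺ʳ (varsCtx Γ) ∘ ∈-++⁺ˡ , z∉ ∘ ⊆-++⁺ʳ (varsCtx Γ) (xs⊆ys++xs (varsCtx Δ) (vars A))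

side : Rule → Side
side (R⇒at _ _ _ _ _ _)    = R
side (R⇒∧ _ _ _ _ _)       = R
side (R∧⇒ _ _ _ _ _)       = L
side (R⇒∨ _ _ _ _ _)       = R
side (R∨⇒ _ _ _ _ _)       = L
side (R⇒→ _ _ _ _ _)       = R
side (R→⇒ _ _ _ _ _ _ _)   = L
side (R⇒∀ _ _ _ _ _ _ _)   = R
side (R∀⇒ _ _ _ _ _ _)     = L
side (R⇒∃ _ _ _ _ _ _)     = R
side (R∃⇒ _ _ _ _ _ _ _)   = L

principal : Rule → LFm
principal (R⇒at _ _ X n i xs)     = X , atom n i xs
principal (R⇒∧ _ _ X φ ψ)         = X , φ ∧' ψ
principal (R∧⇒ _ _ X φ ψ)         = X , φ ∧' ψ
principal (R⇒∨ _ _ X φ ψ)         = X , φ ∨' ψ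
principal (R∨⇒ _ _ X φ ψ)         = X , φ ∨' ψ
principal (R⇒→ _ _ X φ ψ)         = X , φ ⇒' ψ
principal (R→⇒ _ _ X _ φ ψ _)     = X , φ ⇒' ψ
principal (R⇒∀ _ _ X x φ _ _)     = X , ∀' x φ
principal (R∀⇒ _ _ X x φ _)       = X , ∀' x φ
principal (R⇒∃ _ _ X x φ _)       = X , ∃' x φ
principal (R∃⇒ _ _ X x φ _ _)     = X , ∃' x φ

context : Rule → Seq
context (R⇒at Γ Δ _ _ _ _)   = Γ , Δ
context (R⇒∧ Γ Δ _ _ _)      = Γ , Δ
context (R∧⇒ Γ Δ _ _ _)      = Γ , Δ
context (R⇒∨ Γ Δ _ _ _)      = Γ , Δ
context (R∨⇒ Γ Δ _ _ _)      = Γ , Δ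
context (R⇒→ Γ Δ _ _ _)      = Γ , Δ
context (R→⇒ Γ Δ _ _ _ _ _)  = Γ , Δ
context (R⇒∀ Γ Δ _ _ _ _ _)  = Γ , Δ
context (R∀⇒ Γ Δ _ _ _ _)    = Γ , Δ
context (R⇒∃ Γ Δ _ _ _ _)    = Γ , Δ
context (R∃⇒ Γ Δ _ _ _ _ _)  = Γ , Δ

concl≡plug : ∀ r → concl r ≡ plug (side r) (principal r) (context r)
concl≡plug (R⇒at _ _ _ _ _ _)    = refl
concl≡plug (R⇒∧ _ _ _ _ _)       = refl
concl≡plug (R∧⇒ _ _ _ _ _)       = refl
concl≡plug (R⇒∨ _ _ _ _ _)       = refl
concl≡plug (R∨⇒ _ _ _ _ _)       = refl
concl≡plug (R⇒→ _ _ _ _ _)       = refl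
concl≡plug (R→⇒ _ _ _ _ _ _ _)   = refl
concl≡plug (R⇒∀ _ _ _ _ _ _ _)   = refl
concl≡plug (R∀⇒ _ _ _ _ _ _)     = refl
concl≡plug (R⇒∃ _ _ _ _ _ _)     = refl
concl≡plug (R∃⇒ _ _ _ _ _ _ _)   = refl

-- Active formulas of the premises of the rules inverted by induction; for ⇒∀ and
-- ∃⇒ every instance counts, not only a fresh one.
Unfolding : Side → LFm → List Signed → Set
Unfolding R (X , atom n i xs) a = Σ[ k ∈ ℕ ] k ∈L X × a ≡ [ R , sing k , atom n i xs ]
Unfolding R (X , φ ∧' ψ)      a = a ≡ [ R , X , φ ] ⊎ a ≡ [ R , X , ψ ]
Unfolding L (X , φ ∧' ψ)      a = a ≡ (L , X , φ) ∷ (L , X , ψ) ∷ []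
Unfolding R (X , φ ∨' ψ)      a = a ≡ (R , X , φ) ∷ (R , X , ψ) ∷ []
Unfolding L (X , φ ∨' ψ)      a = a ≡ [ L , X , φ ] ⊎ a ≡ [ L , X , ψ ]
Unfolding R (X , φ ⇒' ψ)      a = Σ[ Y ∈ Label ] Y ⊆L X × a ≡ (L , Y , φ) ∷ (R , Y , ψ) ∷ []
Unfolding R (X , ∀' x φ)      a = Σ[ y ∈ Var ] a ≡ [ R , X , φ [ y / x ] ]
Unfolding L (X , ∃' x φ)      a = Σ[ y ∈ Var ] a ≡ [ L , X , φ [ y / x ] ]
Unfolding _ _                 _ = ⊥

Active : Rule → List Signed → Set
Active r@(R⇒at _ _ _ _ _ _)  = Unfolding (side r) (principal r)
Active r@(R⇒∧ _ _ _ _ _)     = Unfolding (side r) (principal r)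
Active r@(R∧⇒ _ _ _ _ _)     = Unfolding (side r) (principal r)
Active r@(R⇒∨ _ _ _ _ _)     = Unfolding (side r) (principal r)
Active r@(R∨⇒ _ _ _ _ _)     = Unfolding (side r) (principal r)
Active r@(R⇒→ _ _ _ _ _)     = Unfolding (side r) (principal r)
Active (R→⇒ _ _ X Y φ ψ _) a =
  a ≡ (L , X , φ ⇒' ψ) ∷ (R , Y , φ) ∷ [] ⊎ a ≡ (L , Y , ψ) ∷ (L , X , φ ⇒' ψ) ∷ []
Active (R⇒∀ _ _ X x φ z _) a = a ≡ [ R , X , φ [ z / x ] ]
Active (R∀⇒ _ _ X x φ y)   a = a ≡ (L , X , φ [ y / x ]) ∷ (L , X , ∀' x φ) ∷ []
Active (R⇒∃ _ _ X x φ y)   a = a ≡ (R , X , ∃' x φ) ∷ (R , X , φ [ y / x ]) ∷ []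
Active (R∃⇒ _ _ X x φ z _) a = a ≡ [ L , X , φ [ z / x ] ]

prem→active : ∀ r {t} → Prem r t → Σ[ a ∈ List Signed ] Active r a × t ≡ a ⊕ context r
prem→active (R⇒at _ _ _ _ _ _)  (k , k∈ , refl) = _ , (k , k∈ , refl) , refl
prem→active (R⇒∧ _ _ _ _ _)     (inj₁ refl)     = _ , inj₁ refl , refl
prem→active (R⇒∧ _ _ _ _ _)     (inj₂ refl)     = _ , inj₂ refl , refl
prem→active (R∧⇒ _ _ _ _ _)     refl            = _ , refl , refl
prem→active (R⇒∨ _ _ _ _ _)     refl            = _ , refl , refl
prem→active (R∨⇒ _ _ _ _ _)     (inj₁ refl)     = _ , inj₁ refl , refl
prem→active (R∨⇒ _ _ _ _ _)     (inj₂ refl)     = _ , inj₂ refl , refl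
prem→active (R⇒→ _ _ _ _ _)     (Y , Y⊆ , refl) = _ , (Y , Y⊆ , refl) , refl
prem→active (R→⇒ _ _ _ _ _ _ _) (inj₁ refl)     = _ , inj₁ refl , refl
prem→active (R→⇒ _ _ _ _ _ _ _) (inj₂ refl)     = _ , inj₂ refl , refl
prem→active (R⇒∀ _ _ _ _ _ _ _) refl            = _ , refl , refl
prem→active (R∀⇒ _ _ _ _ _ _)   refl            = _ , refl , refl
prem→active (R⇒∃ _ _ _ _ _ _)   refl            = _ , refl , refl
prem→active (R∃⇒ _ _ _ _ _ _ _) refl            = _ , refl , refl

active→prem : ∀ r {a} → Active r a → Prem r (a ⊕ context r)
active→prem (R⇒at _ _ _ _ _ _)  (k , k∈ , refl) = k , k∈ , refl
active→prem (R⇒∧ _ _ _ _ _)     (inj₁ refl)     = inj₁ refl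
active→prem (R⇒∧ _ _ _ _ _)     (inj₂ refl)     = inj₂ refl
active→prem (R∧⇒ _ _ _ _ _)     refl            = refl
active→prem (R⇒∨ _ _ _ _ _)     refl            = refl
active→prem (R∨⇒ _ _ _ _ _)     (inj₁ refl)     = inj₁ refl
active→prem (R∨⇒ _ _ _ _ _)     (inj₂ refl)     = inj₂ refl
active→prem (R⇒→ _ _ _ _ _)     (Y , Y⊆ , refl) = Y , Y⊆ , refl
active→prem (R→⇒ _ _ _ _ _ _ _) (inj₁ refl)     = inj₁ refl
active→prem (R→⇒ _ _ _ _ _ _ _) (inj₂ refl)     = inj₂ refl
active→prem (R⇒∀ _ _ _ _ _ _ _) refl            = refl
active→prem (R∀⇒ _ _ _ _ _ _)   refl            = refl
active→prem (R⇒∃ _ _ _ _ _ _)   refl            = refl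
active→prem (R∃⇒ _ _ _ _ _ _ _) refl            = refl

⊢-resp-≈ : ∀ {h s t} → ⊢[ h ] s → s ≈S t → ⊢[ h ] t
⊢-resp-≈ (init q ax)  s≈t = init (≈S-trans (≈S-sym s≈t) q) ax
⊢-resp-≈ (rule r q f) s≈t = rule r (≈S-trans (≈S-sym s≈t) q) f

⊢-lift : ∀ {h s} → ⊢[ h ] s → ⊢[ suc h ] s
⊢-lift (init q ax)  = init q ax
⊢-lift (rule r q f) = rule r q (λ t p → ⊢-lift (f t p))

≈concl⇒≈plug : ∀ {s} r → s ≈S concl r → s ≈S plug (side r) (principal r) (context r)
≈concl⇒≈plug r q = ≈S-trans q (≈S-reflexive (concl≡plug r))

PremisesIn : ℕ → Rule → Seq → Set
PremisesIn h r C = ∀ a → Active r a → ⊢[ h ] a ⊕ C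

premises : ∀ {h} r → (∀ t → Prem r t → ⊢[ h ] t) → PremisesIn h r (context r)
premises r f a act = f _ (active→prem r act)

Instance : Side → LFm → Seq → Set
Instance sd p C = Σ[ r ∈ Rule ] side r ≡ sd × principal r ≡ p × context r ≡ C

apply : ∀ {h sd p C} ((r , _) : Instance sd p C) → PremisesIn h r C → ⊢[ suc h ] plug sd p C
apply (r , refl , refl , refl) prems = rule r (≈S-reflexive (sym (concl≡plug r))) prem
  where
  prem : ∀ t → Prem r t → ⊢[ _ ] t
  prem t p with a , act , refl ← prem→active r p = prems a act

data Axiomatic : Seq → Set where
  id-pair : ∀ {Γ Δ X Y n i xs} → Y ⊆L X →
            (X , atom n i xs) ∈ Γ → (Y , atom n i xs) ∈ Δ → Axiomatic (Γ , Δ)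
  ⊥-left  : ∀ {Γ Δ X} → (X , ⊥') ∈ Γ → Axiomatic (Γ , Δ)

_⊆S_ : Seq → Seq → Set
(Γ , Δ) ⊆S (Γ′ , Δ′) = Γ ⊆ Γ′ × Δ ⊆ Δ′

Axiomatic-mono : ∀ {s t} → s ⊆S t → Axiomatic s → Axiomatic t
Axiomatic-mono (Γ⊆ , Δ⊆) (id-pair Y⊆X X∈ Y∈) = id-pair Y⊆X (Γ⊆ X∈) (Δ⊆ Y∈)
Axiomatic-mono (Γ⊆ , Δ⊆) (⊥-left X∈)         = ⊥-left (Γ⊆ X∈)

≈S⇒⊆S : ∀ {s t} → s ≈S t → s ⊆S t
≈S⇒⊆S (Γ≈ , Δ≈) = ⊆-reflexive-↭ Γ≈ , ⊆-reflexive-↭ Δ≈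

⊆S-trans : ∀ {s t u} → s ⊆S t → t ⊆S u → s ⊆S u
⊆S-trans (Γ⊆ , Δ⊆) (Γ⊆′ , Δ⊆′) = Γ⊆′ ∘ Γ⊆ , Δ⊆′ ∘ Δ⊆

⊆S-plug : ∀ sd p C → C ⊆S plug sd p C
⊆S-plug L p C = xs⊆x∷xs _ p , id
⊆S-plug R p C = id , xs⊆x∷xs _ p

⊆S-⊕ : ∀ a C → C ⊆S a ⊕ C
⊆S-⊕ []              C = id , id
⊆S-⊕ ((sd , p) ∷ a) C = ⊆S-trans (⊆S-⊕ a C) (⊆S-plug sd p (a ⊕ C))

Initial⇒Axiomatic : ∀ {s} → Initial s → Axiomatic s
Initial⇒Axiomatic (ax-id Γ Δ X Y n i xs Y⊆X) = id-pair Y⊆X (here refl) (here refl)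
Initial⇒Axiomatic (ax-⊥ Γ Δ X)               = ⊥-left (here refl)

Axiomatic⇒⊢ : ∀ {h s} → Axiomatic s → ⊢[ h ] s
Axiomatic⇒⊢ (id-pair {X = X} {Y} {n} {i} {xs} Y⊆X X∈ Y∈)
  with Γ₀ , Γ≈ ← ∈⇒↭∷ X∈ | Δ₀ , Δ≈ ← ∈⇒↭∷ Y∈ = init (Γ≈ , Δ≈) (ax-id Γ₀ Δ₀ X Y n i xs Y⊆X)
Axiomatic⇒⊢ {s = _ , Δ} (⊥-left {X = X} X∈)
  with Γ₀ , Γ≈ ← ∈⇒↭∷ X∈ = init (Γ≈ , ↭-refl) (ax-⊥ Γ₀ Δ X)

init⇒Axiomatic : ∀ {s t} → s ≈S t → Initial t → Axiomatic s
init⇒Axiomatic q ax = Axiomatic-mono (≈S⇒⊆S (≈S-sym q)) (Initial⇒Axiomatic ax)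

Renamed : (Var → Var) → LFm → LFm → Set
Renamed σ (X , φ) (X′ , φ′) = X ≡ X′ × ⌊ φ′ ⌋ ≡ ⌊ φ ∣ σ ⌋

Embeds : (Var → Var) → List LFm → List LFm → Set
Embeds σ Γ Γ′ = Σ[ Γ₁ ∈ List LFm ] Σ[ Γ₂ ∈ List LFm ] Pointwise (Renamed σ) Γ Γ₁ × Γ′ ↭ Γ₁ ++ Γ₂

EmbedsS : (Var → Var) → Seq → Seq → Set
EmbedsS σ (Γ , Δ) (Γ′ , Δ′) = Embeds σ Γ Γ′ × Embeds σ Δ Δ′

Pointwise-↭ : ∀ {A B : Set} {R : A → B → Set} {xs xs′ ys} → Pointwise R xs ys → xs ↭ xs′ →
              Σ[ ys′ ∈ List B ] Pointwise R xs′ ys′ × ys ↭ ys′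
Pointwise-↭ rs ↭.refl = _ , rs , ↭-refl
Pointwise-↭ (r ∷ rs) (↭.prep _ p) with _ , rs′ , q ← Pointwise-↭ rs p = _ , r ∷ rs′ , ↭-prep _ q
Pointwise-↭ (r₁ ∷ r₂ ∷ rs) (↭.swap _ _ p) with _ , rs′ , q ← Pointwise-↭ rs p =
  _ , r₂ ∷ r₁ ∷ rs′ , ↭-swap _ _ q
Pointwise-↭ rs (↭.trans p₁ p₂)
  with _ , rs₁ , q₁ ← Pointwise-↭ rs p₁
  with _ , rs₂ , q₂ ← Pointwise-↭ rs₁ p₂ = _ , rs₂ , ↭-trans q₁ q₂

Pointwise⇒Embeds : ∀ {σ Γ Γ′} → Pointwise (Renamed σ) Γ Γ′ → Embeds σ Γ Γ′
Pointwise⇒Embeds {Γ′ = Γ′} rs = Γ′ , [] , rs , ↭-reflexive (sym (++-identityʳ Γ′))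

EmbedsS-refl : ∀ C → EmbedsS id C C
EmbedsS-refl C = Pointwise⇒Embeds reflexive , Pointwise⇒Embeds reflexive
  where
  reflexive : ∀ {Γ} → Pointwise (Renamed id) Γ Γ
  reflexive = Pointwise.refl (refl , refl)

Embeds-↭ : ∀ {σ Γ Γ₀ Γ′} → Embeds σ Γ Γ′ → Γ ↭ Γ₀ → Embeds σ Γ₀ Γ′
Embeds-↭ (Γ₁ , Γ₂ , rs , q) p with Γ₁′ , rs′ , q′ ← Pointwise-↭ rs p =
  Γ₁′ , Γ₂ , rs′ , ↭-trans q (++⁺ʳ Γ₂ q′)

EmbedsS-≈ : ∀ {σ s t s′} → EmbedsS σ s s′ → s ≈S t → EmbedsS σ t s′
EmbedsS-≈ (Γ↪ , Δ↪) (Γ≈ , Δ≈) = Embeds-↭ Γ↪ Γ≈ , Embeds-↭ Δ↪ Δ≈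

EmbedsS-unplug : ∀ {σ} sd p C {s′} → EmbedsS σ (plug sd p C) s′ →
                 Σ[ p′ ∈ LFm ] Σ[ C′ ∈ Seq ] Renamed σ p p′ × EmbedsS σ C C′ × s′ ≈S plug sd p′ C′
EmbedsS-unplug L p C ((p′ ∷ Γ₁ , Γ₂ , r ∷ rs , q) , Δ↪) =
  p′ , (Γ₁ ++ Γ₂ , _) , r , ((Γ₁ , Γ₂ , rs , ↭-refl) , Δ↪) , (q , ↭-refl)
EmbedsS-unplug R p C (Γ↪ , (p′ ∷ Δ₁ , Δ₂ , r ∷ rs , q)) =
  p′ , (_ , Δ₁ ++ Δ₂) , r , (Γ↪ , (Δ₁ , Δ₂ , rs , ↭-refl)) , (↭-refl , q)

Embeds-cons : ∀ {σ p p′ Γ Γ′} → Renamed σ p p′ → Embeds σ Γ Γ′ → Embeds σ (p ∷ Γ) (p′ ∷ Γ′)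
Embeds-cons {p′ = p′} r (Γ₁ , Γ₂ , rs , q) = p′ ∷ Γ₁ , Γ₂ , r ∷ rs , ↭-prep p′ q

EmbedsS-plug : ∀ {σ p p′ C C′} sd → Renamed σ p p′ → EmbedsS σ C C′ →
               EmbedsS σ (plug sd p C) (plug sd p′ C′)
EmbedsS-plug L r (Γ↪ , Δ↪) = Embeds-cons r Γ↪ , Δ↪
EmbedsS-plug R r (Γ↪ , Δ↪) = Γ↪ , Embeds-cons r Δ↪

Embeds-weaken : ∀ {σ Γ Γ′} p → Embeds σ Γ Γ′ → Embeds σ Γ (p ∷ Γ′)
Embeds-weaken p (Γ₁ , Γ₂ , rs , q) = Γ₁ , p ∷ Γ₂ , rs , ↭-trans (↭-prep p q) (↭-sym (↭-shift p Γ₁ Γ₂))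

EmbedsS-weaken : ∀ {σ C C′} sd p → EmbedsS σ C C′ → EmbedsS σ C (plug sd p C′)
EmbedsS-weaken L p (Γ↪ , Δ↪) = Embeds-weaken p Γ↪ , Δ↪
EmbedsS-weaken R p (Γ↪ , Δ↪) = Γ↪ , Embeds-weaken p Δ↪

Embeds-update : ∀ {σ Γ Γ′} z z′ → z ∉ varsCtx Γ → Embeds σ Γ Γ′ → Embeds (σ [ z ↦ z′ ]) Γ Γ′
Embeds-update {σ} z z′ z∉ (Γ₁ , Γ₂ , rs , q) = Γ₁ , Γ₂ , updated z∉ rs , q
  where
  updated : ∀ {Γ Γ₁} → z ∉ varsCtx Γ → Pointwise (Renamed σ) Γ Γ₁ → Pointwise (Renamed (σ [ z ↦ z′ ])) Γ Γ₁
  updated z∉ [] = []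
  updated {(_ , φ) ∷ _} z∉ ((X≡ , e) ∷ rs) =
    (X≡ , trans e (sym (update-fresh σ z z′ φ (z∉ ∘ ∈-++⁺ˡ)))) ∷ updated (z∉ ∘ ∈-++⁺ʳ (vars φ)) rs

EmbedsS-update : ∀ {σ C C′} z z′ → z ∉ varsSeq C → EmbedsS σ C C′ → EmbedsS (σ [ z ↦ z′ ]) C C′
EmbedsS-update {C = Γ , Δ} z z′ z∉ (Γ↪ , Δ↪) =
  Embeds-update z z′ (z∉ ∘ ∈-++⁺ˡ) Γ↪ , Embeds-update z z′ (z∉ ∘ ∈-++⁺ʳ (varsCtx Γ)) Δ↪

∈-Pointwise : ∀ {A B : Set} {R : A → B → Set} {x xs ys} → x ∈ xs → Pointwise R xs ys →
              Σ[ y ∈ B ] R x y × y ∈ ys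
∈-Pointwise (here refl) (r ∷ _)  = _ , r , here refl
∈-Pointwise (there x∈) (_ ∷ rs) with y , r , y∈ ← ∈-Pointwise x∈ rs = y , r , there y∈

∈-Embeds : ∀ {σ p Γ Γ′} → p ∈ Γ → Embeds σ Γ Γ′ → Σ[ p′ ∈ LFm ] Renamed σ p p′ × p′ ∈ Γ′
∈-Embeds p∈ (Γ₁ , Γ₂ , rs , q) with p′ , r , p′∈ ← ∈-Pointwise p∈ rs =
  p′ , r , ∈-resp-↭ (↭-sym q) (∈-++⁺ˡ p′∈)

Axiomatic-rename : ∀ {σ s s′} → Axiomatic s → EmbedsS σ s s′ → Axiomatic s′
Axiomatic-rename {σ} (id-pair {xs = xs} Y⊆X X∈ Y∈) (Γ↪ , Δ↪)
  with (_ , A) , (refl , eA) , A∈ ← ∈-Embeds X∈ Γ↪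
     | (_ , B) , (refl , eB) , B∈ ← ∈-Embeds Y∈ Δ↪
  rewrite ⌊⌋-atom σ xs eA | ⌊⌋-atom σ xs eB = id-pair Y⊆X A∈ B∈
Axiomatic-rename (⊥-left X∈) (Γ↪ , _)
  with (_ , A) , (refl , eA) , A∈ ← ∈-Embeds X∈ Γ↪
  rewrite ⌊⌋≡⊥ᴰ eA = ⊥-left A∈

PremisesRenamed : Rule → Rule → Seq → Set
PremisesRenamed r r′ C′ =
  ∀ a′ → Active r′ a′ →
  Σ[ a ∈ List Signed ] Active r a × Σ[ σ′ ∈ (Var → Var) ] EmbedsS σ′ (a ⊕ context r) (a′ ⊕ C′)

rename-rule : ∀ r σ {p′ C′} → Renamed σ (principal r) p′ → EmbedsS σ (context r) C′ →
              Σ[ (r′ , _) ∈ Instance (side r) p′ C′ ] PremisesRenamed r r′ C′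
rename-rule (R⇒at _ _ X n i xs) σ {_ , _} {Γ′ , Δ′} (refl , e) C↪
  with refl ← ⌊⌋-atom σ xs e =
  (R⇒at Γ′ Δ′ X n i (Vec.map σ xs) , refl , refl , refl) ,
  λ { _ (k , k∈ , refl) → _ , (k , k∈ , refl) , σ , EmbedsS-plug R (refl , e) C↪ }
rename-rule (R⇒∧ _ _ X φ ψ) σ {_ , _} {Γ′ , Δ′} (refl , e) C↪
  with φ′ , ψ′ , refl , e₁ , e₂ ← ⌊⌋≡∧ᴰ e =
  (R⇒∧ Γ′ Δ′ X φ′ ψ′ , refl , refl , refl) ,
  λ { _ (inj₁ refl) → _ , inj₁ refl , σ , EmbedsS-plug R (refl , e₁) C↪
    ; _ (inj₂ refl) → _ , inj₂ refl , σ , EmbedsS-plug R (refl , e₂) C↪ }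
rename-rule (R∧⇒ _ _ X φ ψ) σ {_ , _} {Γ′ , Δ′} (refl , e) C↪
  with φ′ , ψ′ , refl , e₁ , e₂ ← ⌊⌋≡∧ᴰ e =
  (R∧⇒ Γ′ Δ′ X φ′ ψ′ , refl , refl , refl) ,
  λ { _ refl → _ , refl , σ , EmbedsS-plug L (refl , e₁) (EmbedsS-plug L (refl , e₂) C↪) }
rename-rule (R⇒∨ _ _ X φ ψ) σ {_ , _} {Γ′ , Δ′} (refl , e) C↪
  with φ′ , ψ′ , refl , e₁ , e₂ ← ⌊⌋≡∨ᴰ e =
  (R⇒∨ Γ′ Δ′ X φ′ ψ′ , refl , refl , refl) ,
  λ { _ refl → _ , refl , σ , EmbedsS-plug R (refl , e₁) (EmbedsS-plug R (refl , e₂) C↪) }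
rename-rule (R∨⇒ _ _ X φ ψ) σ {_ , _} {Γ′ , Δ′} (refl , e) C↪
  with φ′ , ψ′ , refl , e₁ , e₂ ← ⌊⌋≡∨ᴰ e =
  (R∨⇒ Γ′ Δ′ X φ′ ψ′ , refl , refl , refl) ,
  λ { _ (inj₁ refl) → _ , inj₁ refl , σ , EmbedsS-plug L (refl , e₁) C↪
    ; _ (inj₂ refl) → _ , inj₂ refl , σ , EmbedsS-plug L (refl , e₂) C↪ }
rename-rule (R⇒→ _ _ X φ ψ) σ {_ , _} {Γ′ , Δ′} (refl , e) C↪
  with φ′ , ψ′ , refl , e₁ , e₂ ← ⌊⌋≡⇒ᴰ e =
  (R⇒→ Γ′ Δ′ X φ′ ψ′ , refl , refl , refl) ,
  λ { _ (Y , Y⊆ , refl) →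
        _ , (Y , Y⊆ , refl) , σ , EmbedsS-plug L (refl , e₁) (EmbedsS-plug R (refl , e₂) C↪) }
rename-rule (R→⇒ _ _ X Y φ ψ Y⊆) σ {_ , _} {Γ′ , Δ′} (refl , e) C↪
  with φ′ , ψ′ , refl , e₁ , e₂ ← ⌊⌋≡⇒ᴰ e =
  (R→⇒ Γ′ Δ′ X Y φ′ ψ′ Y⊆ , refl , refl , refl) ,
  λ { _ (inj₁ refl) → _ , inj₁ refl , σ , EmbedsS-plug L (refl , e) (EmbedsS-plug R (refl , e₁) C↪)
    ; _ (inj₂ refl) → _ , inj₂ refl , σ , EmbedsS-plug L (refl , e₂) (EmbedsS-plug L (refl , e) C↪) }
rename-rule (R⇒∀ Γ Δ X x φ z z∉) σ {_ , _} {Γ′ , Δ′} (refl , e) C↪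
  with y , ψ , refl , e₀ ← ⌊⌋≡∀ᴰ e
     | z∉φ , z∉C ← ∉-plug R X (∀' x φ) (Γ , Δ) z∉ =
  (R⇒∀ Γ′ Δ′ X y ψ z′ (fresh∉ _) , refl , refl , refl) ,
  λ { _ refl → _ , refl , σ [ z ↦ z′ ] ,
        EmbedsS-plug R (refl , eigen-renamed σ x φ y ψ z z′ z∉φ e₀) (EmbedsS-update z z′ z∉C C↪) }
  where z′ = fresh (varsSeq (Γ′ , (X , ∀' y ψ) ∷ Δ′))
rename-rule (R∀⇒ _ _ X x φ t) σ {_ , _} {Γ′ , Δ′} (refl , e) C↪
  with y , ψ , refl , e₀ ← ⌊⌋≡∀ᴰ e =
  (R∀⇒ Γ′ Δ′ X y ψ (σ t) , refl , refl , refl) ,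
  λ { _ refl → _ , refl , σ ,
        EmbedsS-plug L (refl , instance-renamed σ x φ y ψ t e₀) (EmbedsS-plug L (refl , e) C↪) }
rename-rule (R⇒∃ _ _ X x φ t) σ {_ , _} {Γ′ , Δ′} (refl , e) C↪
  with y , ψ , refl , e₀ ← ⌊⌋≡∃ᴰ e =
  (R⇒∃ Γ′ Δ′ X y ψ (σ t) , refl , refl , refl) ,
  λ { _ refl → _ , refl , σ ,
        EmbedsS-plug R (refl , e) (EmbedsS-plug R (refl , instance-renamed σ x φ y ψ t e₀) C↪) }
rename-rule (R∃⇒ Γ Δ X x φ z z∉) σ {_ , _} {Γ′ , Δ′} (refl , e) C↪
  with y , ψ , refl , e₀ ← ⌊⌋≡∃ᴰ e
     | z∉φ , z∉C ← ∉-plug L X (∃' x φ) (Γ , Δ) z∉ =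
  (R∃⇒ Γ′ Δ′ X y ψ z′ (fresh∉ _) , refl , refl , refl) ,
  λ { _ refl → _ , refl , σ [ z ↦ z′ ] ,
        EmbedsS-plug L (refl , eigen-renamed σ x φ y ψ z z′ z∉φ e₀) (EmbedsS-update z z′ z∉C C↪) }
  where z′ = fresh (varsSeq ((X , ∃' y ψ) ∷ Γ′ , Δ′))

⊢-rename : ∀ {h s s′} σ → ⊢[ h ] s → EmbedsS σ s s′ → ⊢[ h ] s′
⊢-rename σ (init q ax) s↪ = Axiomatic⇒⊢ (Axiomatic-rename (init⇒Axiomatic q ax) s↪)
⊢-rename {suc h} σ (rule r q f) s↪
  with p′ , C′ , p↪ , C↪ , s′≈
         ← EmbedsS-unplug (side r) (principal r) (context r) (EmbedsS-≈ s↪ (≈concl⇒≈plug r q))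
  with (r′ , eqs) , renamed ← rename-rule r σ p↪ C↪ =
  ⊢-resp-≈ (apply (r′ , eqs) premise) (≈S-sym s′≈)
  where
  premise : PremisesIn h r′ C′
  premise a′ act′ with a , act , σ′ , emb ← renamed a′ act′ = ⊢-rename σ′ (premises r f a act) emb

⊢-weaken : ∀ {h C} sd p → ⊢[ h ] C → ⊢[ h ] plug sd p C
⊢-weaken {C = C} sd p d = ⊢-rename id d (EmbedsS-weaken sd p (EmbedsS-refl C))

⊢-weaken-⊕ : ∀ {h C} a → ⊢[ h ] C → ⊢[ h ] a ⊕ C
⊢-weaken-⊕ []              d = d
⊢-weaken-⊕ ((sd , p) ∷ a) d = ⊢-weaken sd p (⊢-weaken-⊕ a d)

-- vars (∀' x φ) and vars (∃' x φ) coincide, so this also serves ∃⇒.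
⊢-rename-eigen : ∀ {h X x φ z} sd C y → z ∉ vars (∀' x φ) × z ∉ varsSeq C →
                 ⊢[ h ] plug sd (X , φ [ z / x ]) C → ⊢[ h ] plug sd (X , φ [ y / x ]) C
⊢-rename-eigen {x = x} {φ} {z} sd C y (z∉φ , z∉C) d =
  ⊢-rename (id [ z ↦ y ]) d
    (EmbedsS-plug sd (refl , eigen-renamed id x φ x φ z y z∉φ refl) (EmbedsS-update z y z∉C (EmbedsS-refl C)))

-- Eigenvariables are replaced by one that is fresh for the new context.
transplant : ∀ {h} r → PremisesIn h r (context r) → ∀ C →
             Σ[ (r′ , _) ∈ Instance (side r) (principal r) C ] PremisesIn h r′ (context r)
transplant (R⇒at _ _ X n i xs)   f (Γ′ , Δ′) = (R⇒at Γ′ Δ′ X n i xs , refl , refl , refl) , f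
transplant (R⇒∧ _ _ X φ ψ)       f (Γ′ , Δ′) = (R⇒∧ Γ′ Δ′ X φ ψ , refl , refl , refl) , f
transplant (R∧⇒ _ _ X φ ψ)       f (Γ′ , Δ′) = (R∧⇒ Γ′ Δ′ X φ ψ , refl , refl , refl) , f
transplant (R⇒∨ _ _ X φ ψ)       f (Γ′ , Δ′) = (R⇒∨ Γ′ Δ′ X φ ψ , refl , refl , refl) , f
transplant (R∨⇒ _ _ X φ ψ)       f (Γ′ , Δ′) = (R∨⇒ Γ′ Δ′ X φ ψ , refl , refl , refl) , f
transplant (R⇒→ _ _ X φ ψ)       f (Γ′ , Δ′) = (R⇒→ Γ′ Δ′ X φ ψ , refl , refl , refl) , f
transplant (R→⇒ _ _ X Y φ ψ Y⊆) f (Γ′ , Δ′) = (R→⇒ Γ′ Δ′ X Y φ ψ Y⊆ , refl , refl , refl) , f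
transplant (R∀⇒ _ _ X x φ t)     f (Γ′ , Δ′) = (R∀⇒ Γ′ Δ′ X x φ t , refl , refl , refl) , f
transplant (R⇒∃ _ _ X x φ t)     f (Γ′ , Δ′) = (R⇒∃ Γ′ Δ′ X x φ t , refl , refl , refl) , f
transplant (R⇒∀ Γ Δ X x φ z z∉) f (Γ′ , Δ′) =
  (R⇒∀ Γ′ Δ′ X x φ z′ (fresh∉ _) , refl , refl , refl) ,
  λ { _ refl → ⊢-rename-eigen R (Γ , Δ) z′ (∉-plug R X (∀' x φ) (Γ , Δ) z∉) (f _ refl) }
  where z′ = fresh (varsSeq (Γ′ , (X , ∀' x φ) ∷ Δ′))
transplant (R∃⇒ Γ Δ X x φ z z∉) f (Γ′ , Δ′) =
  (R∃⇒ Γ′ Δ′ X x φ z′ (fresh∉ _) , refl , refl , refl) ,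
  λ { _ refl → ⊢-rename-eigen L (Γ , Δ) z′ (∉-plug L X (∃' x φ) (Γ , Δ) z∉) (f _ refl) }
  where z′ = fresh (varsSeq ((X , ∃' x φ) ∷ Γ′ , Δ′))

commute : ∀ {h} r → PremisesIn h r (context r) → ∀ C →
          (∀ a → ⊢[ h ] a ⊕ context r → ⊢[ h ] a ⊕ C) → ⊢[ suc h ] plug (side r) (principal r) C
commute r f C move with (r′ , eqs) , g ← transplant r f C = apply (r′ , eqs) (λ a act → move a (g a act))

Axiomatic-unfold : ∀ sd p C {a} → Unfolding sd p a → Axiomatic (plug sd p C) → Axiomatic (a ⊕ C)
Axiomatic-unfold L _ C () (id-pair _ (here refl) _)
Axiomatic-unfold L _ C () (⊥-left (here refl))
Axiomatic-unfold L _ C {a} _ (id-pair Y⊆X (there X∈) Y∈) = Axiomatic-mono (⊆S-⊕ a C) (id-pair Y⊆X X∈ Y∈)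
Axiomatic-unfold L _ C {a} _ (⊥-left (there X∈))         = Axiomatic-mono (⊆S-⊕ a C) (⊥-left X∈)
Axiomatic-unfold R _ C (k , k∈Y , refl) (id-pair Y⊆X X∈ (here refl)) =
  id-pair (λ { (here refl) → Y⊆X k∈Y ; (there ()) }) X∈ (here refl)
Axiomatic-unfold R _ C {a} _ (id-pair Y⊆X X∈ (there Y∈)) = Axiomatic-mono (⊆S-⊕ a C) (id-pair Y⊆X X∈ Y∈)
Axiomatic-unfold R _ C {a} _ (⊥-left X∈)                 = Axiomatic-mono (⊆S-⊕ a C) (⊥-left X∈)

unfold-principal : ∀ {h} r → PremisesIn h r (context r) →
                   ∀ {a} → Unfolding (side r) (principal r) a → ⊢[ h ] a ⊕ context r
unfold-principal (R⇒at _ _ _ _ _ _) f u = f _ u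
unfold-principal (R⇒∧ _ _ _ _ _)    f u = f _ u
unfold-principal (R∧⇒ _ _ _ _ _)    f u = f _ u
unfold-principal (R⇒∨ _ _ _ _ _)    f u = f _ u
unfold-principal (R∨⇒ _ _ _ _ _)    f u = f _ u
unfold-principal (R⇒→ _ _ _ _ _)    f u = f _ u
unfold-principal (R→⇒ _ _ _ _ _ _ _) f ()
unfold-principal (R∀⇒ _ _ _ _ _ _)   f ()
unfold-principal (R⇒∃ _ _ _ _ _ _)   f ()
unfold-principal (R⇒∀ Γ Δ X x φ z z∉) f (y , refl) =
  ⊢-rename-eigen R (Γ , Δ) y (∉-plug R X (∀' x φ) (Γ , Δ) z∉) (f _ refl)
unfold-principal (R∃⇒ Γ Δ X x φ z z∉) f (y , refl) =
  ⊢-rename-eigen L (Γ , Δ) y (∉-plug L X (∃' x φ) (Γ , Δ) z∉) (f _ refl)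

⊢-unfold : ∀ {h} sd p C {a} → Unfolding sd p a → ⊢[ h ] plug sd p C → ⊢[ h ] a ⊕ C
⊢-unfold sd p C u (init q ax) = Axiomatic⇒⊢ (Axiomatic-unfold sd p C u (init⇒Axiomatic q ax))
⊢-unfold {suc h} sd p C {a} u (rule r q f)
  with plug-split sd p C (side r) (principal r) (context r) (≈concl⇒≈plug r q)
... | inj₁ (refl , refl , C≈) = ⊢-resp-≈ (⊢-lift (unfold-principal r (premises r f) u)) (⊕-≈ a (≈S-sym C≈))
... | inj₂ (C′ , C≈ , ctx≈) =
  ⊢-resp-≈ (commute r (premises r f) (a ⊕ C′) move)
           (≈S-trans (≈S-sym (⊕-plug a (side r) (principal r) C′)) (⊕-≈ a (≈S-sym C≈)))
  where
  move : ∀ b → ⊢[ h ] b ⊕ context r → ⊢[ h ] b ⊕ a ⊕ C′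
  move b d = ⊢-resp-≈ (⊢-unfold sd p (b ⊕ C′) u (⊢-resp-≈ d (≈S-trans (⊕-≈ b ctx≈) (⊕-plug b sd p C′))))
                      (⊕-comm a b C′)

Retains : Side → LFm → List Signed → Set
Retains sd p a = Σ[ a′ ∈ List Signed ] ∀ C → a ⊕ C ≈S plug sd p (a′ ⊕ C)

active-cases : ∀ r {a} → Active r a → Unfolding (side r) (principal r) a ⊎ Retains (side r) (principal r) a
active-cases (R⇒at _ _ _ _ _ _)  u           = inj₁ u
active-cases (R⇒∧ _ _ _ _ _)     u           = inj₁ u
active-cases (R∧⇒ _ _ _ _ _)     u           = inj₁ u
active-cases (R⇒∨ _ _ _ _ _)     u           = inj₁ u
active-cases (R∨⇒ _ _ _ _ _)     u           = inj₁ u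
active-cases (R⇒→ _ _ _ _ _)     u           = inj₁ u
active-cases (R⇒∀ _ _ _ _ _ z _) refl        = inj₁ (z , refl)
active-cases (R∃⇒ _ _ _ _ _ z _) refl        = inj₁ (z , refl)
active-cases (R→⇒ _ _ X Y φ ψ _) (inj₁ refl) = inj₂ ([ R , Y , φ ] , λ C → ≈S-refl)
active-cases (R→⇒ _ _ X Y φ ψ _) (inj₂ refl) = inj₂ ([ L , Y , ψ ] , plug-swap L _ L _)
active-cases (R∀⇒ _ _ X x φ y)   refl        = inj₂ ([ L , X , φ [ y / x ] ] , plug-swap L _ L _)
active-cases (R⇒∃ _ _ X x φ y)   refl        = inj₂ ([ R , X , φ [ y / x ] ] , λ C → ≈S-refl)

instance-cases : ∀ {sd p C a} ((r , _) : Instance sd p C) → Active r a → Unfolding sd p a ⊎ Retains sd p a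
instance-cases (r , refl , refl , refl) = active-cases r

Contraction : ℕ → Set
Contraction h = ∀ sd p C → ⊢[ h ] plug sd p (plug sd p C) → ⊢[ h ] plug sd p C

contract-⊕ : ∀ {h} → Contraction h → ∀ a C → ⊢[ h ] a ⊕ a ⊕ C → ⊢[ h ] a ⊕ C
contract-⊕ c []              C d = d
contract-⊕ c ((sd , p) ∷ a) C d =
  ⊢-resp-≈ (contract-⊕ c a (plug sd p C) (⊢-resp-≈ (c sd p (a ⊕ a ⊕ C) (⊢-resp-≈ d (plug-≈ sd p pulled)))
                                                   (≈S-sym (≈S-trans (⊕-≈ a (⊕-plug a sd p C)) pulled))))
           (⊕-plug a sd p C)
  where
  pulled : a ⊕ plug sd p (a ⊕ C) ≈S plug sd p (a ⊕ a ⊕ C)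
  pulled = ⊕-plug a sd p (a ⊕ C)

contract-principal : ∀ {h} → Contraction h → ∀ r → PremisesIn h r (context r) → ∀ C →
                     context r ≈S plug (side r) (principal r) C → ⊢[ suc h ] plug (side r) (principal r) C
contract-principal {h} c r f C ctx≈ with (r′ , eqs) , g ← transplant r f C = apply (r′ , eqs) premise
  where
  sd = side r
  p  = principal r
  premise : PremisesIn h r′ C
  premise a act with instance-cases (r′ , eqs) act
  ... | inj₁ u = contract-⊕ c a C (⊢-unfold sd p (a ⊕ C) u (⊢-resp-≈ (g a act) moved))
    where
    moved : a ⊕ context r ≈S plug sd p (a ⊕ C)
    moved = ≈S-trans (⊕-≈ a ctx≈) (⊕-plug a sd p C)
  ... | inj₂ (a′ , a≈) = ⊢-resp-≈ (c sd p (a′ ⊕ C) (⊢-resp-≈ (g a act) moved)) (≈S-sym (a≈ C))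
    where
    moved : a ⊕ context r ≈S plug sd p (plug sd p (a′ ⊕ C))
    moved = ≈S-trans (⊕-≈ a ctx≈) (≈S-trans (⊕-plug a sd p C) (plug-≈ sd p (a≈ C)))

⊢-contract : ∀ h → Contraction h
⊢-contract h sd p C (init q ax) =
  Axiomatic⇒⊢ (Axiomatic-mono (contracted sd) (init⇒Axiomatic q ax))
  where
  contracted : ∀ sd → plug sd p (plug sd p C) ⊆S plug sd p C
  contracted L = (λ { (here refl) → here refl ; (there x∈) → x∈ }) , id
  contracted R = id , (λ { (here refl) → here refl ; (there x∈) → x∈ })
⊢-contract (suc h) sd p C (rule r q f)
  with plug-split sd p (plug sd p C) (side r) (principal r) (context r) (≈concl⇒≈plug r q)
... | inj₁ (refl , refl , C≈) = contract-principal (⊢-contract h) r (premises r f) C (≈S-sym C≈)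
... | inj₂ (C′ , C≈ , ctx≈) with plug-split sd p C (side r) (principal r) C′ C≈
...   | inj₁ (refl , refl , C≈′) =
  contract-principal (⊢-contract h) r (premises r f) C (≈S-trans ctx≈ (plug-≈ sd p (≈S-sym C≈′)))
...   | inj₂ (C″ , C≈″ , C′≈) =
  ⊢-resp-≈ (commute r (premises r f) (plug sd p C″) move)
           (≈S-trans (plug-swap (side r) (principal r) sd p C″) (plug-≈ sd p (≈S-sym C≈″)))
  where
  move : ∀ a → ⊢[ h ] a ⊕ context r → ⊢[ h ] a ⊕ plug sd p C″
  move a d = ⊢-resp-≈ (⊢-contract h sd p (a ⊕ C″) (⊢-resp-≈ d doubled)) (≈S-sym (⊕-plug a sd p C″))
    where
    doubled : a ⊕ context r ≈S plug sd p (plug sd p (a ⊕ C″))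
    doubled = ≈S-trans (⊕-≈ a (≈S-trans ctx≈ (plug-≈ sd p C′≈)))
                (≈S-trans (⊕-plug a sd p (plug sd p C″)) (plug-≈ sd p (⊕-plug a sd p C″)))

⊢-premise : ∀ {h} r {a} → Active r a → ⊢[ h ] plug (side r) (principal r) (context r) → ⊢[ h ] a ⊕ context r
⊢-premise r act d with active-cases r act
... | inj₁ u         = ⊢-unfold (side r) (principal r) (context r) u d
... | inj₂ (a′ , a≈) =
  ⊢-resp-≈ (⊢-weaken-⊕ a′ d) (≈S-trans (⊕-plug a′ (side r) (principal r) (context r)) (≈S-sym (a≈ (context r))))

⊢-invert : ∀ h r s → ⊢[ h ] concl r → Prem r s → ⊢[ h ] s
⊢-invert h r s d prem with a , act , refl ← prem→active r prem =
  ⊢-premise r act (subst (⊢[ h ]_) (concl≡plug r) d)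

substituted : ∀ x z Γ → Pointwise (Renamed (id [ x ↦ z ])) Γ (substCtx z x Γ)
substituted x z []            = []
substituted x z ((X , φ) ∷ Γ) = (refl , db-ren free (id [ x ↦ z ]) φ) ∷ substituted x z Γ

proposition5 :
  -- (i) height-preserving substitution
  (∀ (h : ℕ) (Γ Δ : List LFm) (x z : Var) →
     ⊢[ h ] (Γ , Δ) → ⊢[ h ] (substCtx z x Γ , substCtx z x Δ))
  -- (ii) height-preserving weakening
  × (∀ (h : ℕ) (Γ Δ : List LFm) (X : Label) (φ : Fm) →
       ⊢[ h ] (Γ , Δ) →
       ⊢[ h ] (Γ , Δ ∷ʳ (X , φ)) × ⊢[ h ] ((X , φ) ∷ Γ , Δ))
  -- (iii) height-preserving invertibility of all rules
  × (∀ (h : ℕ) (r : Rule) (s : Seq) →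
       ⊢[ h ] concl r → Prem r s → ⊢[ h ] s)
  -- (iv) height-preserving contraction
  × (∀ (h : ℕ) (Γ Δ : List LFm) (X : Label) (φ : Fm) →
       (⊢[ h ] (Γ , Δ ∷ʳ (X , φ) ∷ʳ (X , φ)) → ⊢[ h ] (Γ , Δ ∷ʳ (X , φ)))
       × (⊢[ h ] ((X , φ) ∷ (X , φ) ∷ Γ , Δ) → ⊢[ h ] ((X , φ) ∷ Γ , Δ)))
proposition5 =
  (λ h Γ Δ x z d →
     ⊢-rename (id [ x ↦ z ]) d
              (Pointwise⇒Embeds (substituted x z Γ) , Pointwise⇒Embeds (substituted x z Δ))) ,
  (λ h Γ Δ X φ d → ⊢-resp-≈ (⊢-weaken R (X , φ) d) (↭-refl , ∷↭∷ʳ (X , φ) Δ) , ⊢-weaken L (X , φ) d) ,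
  ⊢-invert ,
  (λ h Γ Δ X φ →
     (λ d → ⊢-resp-≈ (⊢-contract h R (X , φ) (Γ , Δ) (⊢-resp-≈ d (↭-refl , to-front (X , φ) Δ)))
                     (↭-refl , ∷↭∷ʳ (X , φ) Δ)) ,
     ⊢-contract h L (X , φ) (Γ , Δ))
  where
  to-front : ∀ p Δ → Δ ∷ʳ p ∷ʳ p ↭ p ∷ p ∷ Δ
  to-front p Δ = ↭-trans (↭-sym (∷↭∷ʳ p (Δ ∷ʳ p))) (↭-prep p (↭-sym (∷↭∷ʳ p Δ)))
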